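{- Let $j,k,n$ be positive integers such that $k\leq n+1-j$ and $n\neq 2k-1$. Then \[\left|\binom{n}{k}-\binom{n}{k-1}\right| \;\geq\; \left|\binom{n-j}{k}-\binom{n-j}{k-1}\right|.\]
   Context: Binomial coefficients $\binom{m}{i}$ for integers $m\geq 0$, $i\geq0$ are the usual ones, with $\binom{m}{i}=0$ when $i>m$. -}

module Defs where

-- Write t = k - 1 and g m = ∣ m C (t+1) - m C t ∣. From the ratio (t+1)·C(m,t+1) = (m-t)·C(m,t),
-- row m increases at position t exactly when 2t+1 ≤ m. By Pascal's rule g (m+1) = ∣ C(m,t+1) - C(m,t-1) ∣,
-- and unimodality places C(m,t) between C(m,t+1) and C(m,t-1) whenever m ≠ 2t, so g is nondecreasing
-- on m ≤ 2t and on m ≥ 2t+1. Across the zero g (2t+1) = 0, the symmetry C(2t,t+1) = C(2t,t-1) turns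
-- g (2t) ≤ g (2t+2) into C(2t,t-2) ≤ C(2t,t-1). So g m ≤ g n for all m ≤ n ≠ 2t+1; the theorem is the
-- case m = n - j, and needs none of the hypotheses beyond k ≥ 1 and n ≠ 2k-1.
module Submission where

open import Defs
open import Data.Nat using (ℕ; zero; suc; _+_; _∸_; _*_; _≤_; _<_; z≤n; s≤s; s≤s⁻¹; ∣_-_∣)
open import Data.Nat.Combinatorics using (_C_; nCk+nC[k+1]≡[n+1]C[k+1]; nC1≡n; nCk≡nC[n∸k])
open import Data.Nat.Properties
open import Data.Nat.Tactic.RingSolver using (solve-∀)
open import Data.Sum using (inj₁; inj₂)
open import Data.Empty using (⊥-elim)
open import Relation.Nullary using (yes; no)
open import Relation.Binary.Definitions using (tri<; tri≈; tri>)
open import Relation.Binary.PropositionalEquality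

C-pascal : ∀ n k → suc n C suc k ≡ n C k + n C suc k
C-pascal n k = sym (nCk+nC[k+1]≡[n+1]C[k+1] n k)

C-absorb : ∀ n k → (suc n C suc k) * suc k ≡ suc n * (n C k)
C-absorb n       zero    rewrite nC1≡n (suc n) = refl
C-absorb zero    (suc k) = refl
C-absorb (suc n) (suc k) = begin
  (suc (suc n) C suc (suc k)) * suc (suc k)      ≡⟨ cong (_* suc (suc k)) (C-pascal (suc n) (suc k)) ⟩
  (x + y) * suc (suc k)                          ≡⟨ regroup x y k ⟩
  x * suc k + y * suc (suc k) + x                ≡⟨ cong₂ (λ a b → a + b + x) (C-absorb n k) (C-absorb n (suc k)) ⟩
  suc n * (n C k) + suc n * (n C suc k) + x      ≡⟨ cong (_+ x) (*-distribˡ-+ (suc n) (n C k) (n C suc k)) ⟨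
  suc n * (n C k + n C suc k) + x                ≡⟨ cong (λ z → suc n * z + x) (C-pascal n k) ⟨
  suc n * x + x                                  ≡⟨ +-comm (suc n * x) x ⟩
  suc (suc n) * x                                ∎
  where
  open ≡-Reasoning
  x = suc n C suc k
  y = suc n C suc (suc k)
  regroup : ∀ x y k → (x + y) * suc (suc k) ≡ x * suc k + y * suc (suc k) + x
  regroup = solve-∀

C-ratio : ∀ n k → (n C suc k) * suc k ≡ (n C k) * (n ∸ k)
C-ratio n k = begin
  y * suc k                            ≡⟨ m+n∸m≡n (x * suc k) (y * suc k) ⟨
  x * suc k + y * suc k ∸ x * suc k    ≡⟨ cong (_∸ x * suc k) (*-distribʳ-+ (suc k) x y) ⟨
  (x + y) * suc k ∸ x * suc k          ≡⟨ cong (λ z → z * suc k ∸ x * suc k) (C-pascal n k) ⟨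
  (suc n C suc k) * suc k ∸ x * suc k  ≡⟨ cong (_∸ x * suc k) (trans (C-absorb n k) (*-comm (suc n) x)) ⟩
  x * suc n ∸ x * suc k                ≡⟨ *-distribˡ-∸ x (suc n) (suc k) ⟨
  x * (n ∸ k)                          ∎
  where
  open ≡-Reasoning
  x = n C k
  y = n C suc k

C-≤-C-suc : ∀ {m t} → suc (t + t) ≤ m → m C t ≤ m C suc t
C-≤-C-suc {m} {t} 2t+1≤m = *-cancelʳ-≤ (m C t) (m C suc t) (suc t) (begin
  (m C t) * suc t      ≤⟨ *-monoʳ-≤ (m C t) (m+n≤o⇒m≤o∸n (suc t) 2t+1≤m) ⟩
  (m C t) * (m ∸ t)    ≡⟨ C-ratio m t ⟨
  (m C suc t) * suc t  ∎)
  where open ≤-Reasoning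

C-suc-≤-C : ∀ {m t} → m ≤ suc (t + t) → m C suc t ≤ m C t
C-suc-≤-C {m} {t} m≤2t+1 = *-cancelʳ-≤ (m C suc t) (m C t) (suc t) (begin
  (m C suc t) * suc t  ≡⟨ C-ratio m t ⟩
  (m C t) * (m ∸ t)    ≤⟨ *-monoʳ-≤ (m C t) (m≤n+o⇒m∸n≤o m t (≤-trans m≤2t+1 (≤-reflexive (sym (+-suc t t))))) ⟩
  (m C t) * suc t      ∎)
  where open ≤-Reasoning

C-+-sym : ∀ a b → (a + b) C a ≡ (a + b) C b
C-+-sym a b = trans (nCk≡nC[n∸k] (m≤m+n a b)) (cong ((a + b) C_) (m+n∸m≡n a b))

2t+1≤2t+3 : ∀ t → suc (t + t) ≤ suc (suc t + suc t)
2t+1≤2t+3 t = s≤s (+-mono-≤ (n≤1+n t) (n≤1+n t))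

-- C(m,t-1), with the convention C(m,-1) = 0 (truncated subtraction would give m C 0).
C-below : ℕ → ℕ → ℕ
C-below m zero    = 0
C-below m (suc s) = m C s

C-pascal-below : ∀ m t → suc m C t ≡ m C t + C-below m t
C-pascal-below m zero    = refl
C-pascal-below m (suc s) = trans (C-pascal m s) (+-comm (m C s) (m C suc s))

C-below-≤-C : ∀ {m t} → suc (t + t) ≤ m → C-below m t ≤ m C t
C-below-≤-C {t = zero}  _      = z≤n
C-below-≤-C {t = suc s} 2t+1≤m = C-≤-C-suc (≤-trans (2t+1≤2t+3 s) 2t+1≤m)

m≤n≤o⇒∣o-n∣≤∣o-m∣ : ∀ {m n o} → m ≤ n → n ≤ o → ∣ o - n ∣ ≤ ∣ o - m ∣
m≤n≤o⇒∣o-n∣≤∣o-m∣ {m} {n} {o} m≤n n≤o = begin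
  ∣ o - n ∣  ≡⟨ m≤n⇒∣n-m∣≡n∸m n≤o ⟩
  o ∸ n      ≤⟨ ∸-monoʳ-≤ o m≤n ⟩
  o ∸ m      ≡⟨ m≤n⇒∣n-m∣≡n∸m (≤-trans m≤n n≤o) ⟨
  ∣ o - m ∣  ∎
  where open ≤-Reasoning

m≤n≤o⇒∣m-n∣≤∣m-o∣ : ∀ {m n o} → m ≤ n → n ≤ o → ∣ m - n ∣ ≤ ∣ m - o ∣
m≤n≤o⇒∣m-n∣≤∣m-o∣ {m} {n} {o} m≤n n≤o = begin
  ∣ m - n ∣  ≡⟨ ∣-∣-comm m n ⟩
  ∣ n - m ∣  ≡⟨ m≤n⇒∣n-m∣≡n∸m m≤n ⟩
  n ∸ m      ≤⟨ ∸-monoˡ-≤ m n≤o ⟩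
  o ∸ m      ≡⟨ m≤n⇒∣n-m∣≡n∸m (≤-trans m≤n n≤o) ⟨
  ∣ o - m ∣  ≡⟨ ∣-∣-comm o m ⟩
  ∣ m - o ∣  ∎
  where open ≤-Reasoning

steps-≤⇒≤ : ∀ (f : ℕ → ℕ) {a b} → (∀ {m} → a ≤ m → m < b → f m ≤ f (suc m)) → a ≤ b → f a ≤ f b
steps-≤⇒≤ f {b = zero}  step z≤n   = ≤-refl
steps-≤⇒≤ f {b = suc b} step a≤1+b with m≤n⇒m<n∨m≡n a≤1+b
... | inj₂ refl  = ≤-refl
... | inj₁ a<1+b = ≤-trans (steps-≤⇒≤ f (λ a≤m m<b → step a≤m (m<n⇒m<1+n m<b)) a≤b) (step a≤b ≤-refl)
  where a≤b = s≤s⁻¹ a<1+b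

C-gap : ℕ → ℕ → ℕ
C-gap t m = ∣ m C suc t - m C t ∣

C-gap-suc : ∀ t m → C-gap t (suc m) ≡ ∣ m C suc t - C-below m t ∣
C-gap-suc t m = begin
  ∣ suc m C suc t - suc m C t ∣                 ≡⟨ cong₂ ∣_-_∣ (C-pascal m t) (C-pascal-below m t) ⟩
  ∣ m C t + m C suc t - m C t + C-below m t ∣   ≡⟨ ∣m+n-m+o∣≡∣n-o∣ (m C t) (m C suc t) (C-below m t) ⟩
  ∣ m C suc t - C-below m t ∣                   ∎
  where open ≡-Reasoning

C-gap-step-above : ∀ {t m} → suc (t + t) ≤ m → C-gap t m ≤ C-gap t (suc m)
C-gap-step-above {t} {m} 2t+1≤m =
  subst (C-gap t m ≤_) (sym (C-gap-suc t m))
    (m≤n≤o⇒∣o-n∣≤∣o-m∣ (C-below-≤-C {m} {t} 2t+1≤m) (C-≤-C-suc {m} {t} 2t+1≤m))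

C-gap-step-below : ∀ {t m} → suc m ≤ t + t → C-gap t m ≤ C-gap t (suc m)
C-gap-step-below {suc s} {m} m<2t =
  subst (C-gap (suc s) m ≤_) (sym (C-gap-suc (suc s) m))
    (m≤n≤o⇒∣m-n∣≤∣m-o∣ (C-suc-≤-C (≤-trans m≤2s+1 (2t+1≤2t+3 s))) (C-suc-≤-C m≤2s+1))
  where
  m≤2s+1 : m ≤ suc (s + s)
  m≤2s+1 = ≤-trans (s≤s⁻¹ m<2t) (≤-reflexive (+-suc s s))

C-gap-mono-above : ∀ {t a b} → suc (t + t) ≤ a → a ≤ b → C-gap t a ≤ C-gap t b
C-gap-mono-above {t} 2t+1≤a = steps-≤⇒≤ (C-gap t) (λ a≤m _ → C-gap-step-above (≤-trans 2t+1≤a a≤m))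

C-gap-mono-below : ∀ {t a b} → b ≤ t + t → a ≤ b → C-gap t a ≤ C-gap t b
C-gap-mono-below {t} b≤2t = steps-≤⇒≤ (C-gap t) (λ _ m<b → C-gap-step-below (≤-trans m<b b≤2t))

C-gap-cross : ∀ t → C-gap t (t + t) ≤ C-gap t (suc (suc (t + t)))
C-gap-cross zero    = ≤-refl
C-gap-cross (suc s) rewrite +-suc s s = begin
  C-gap (suc s) M                               ≡⟨ cong (λ z → ∣ z - M C suc s ∣) (C-+-sym (suc (suc s)) s) ⟩
  ∣ M C s - M C suc s ∣                         ≡⟨ ∣-∣-comm (M C s) (M C suc s) ⟩
  ∣ M C suc s - M C s ∣                         ≤⟨ m≤n≤o⇒∣o-n∣≤∣o-m∣ (C-below-≤-C {M} {s} 2s+1≤M) (C-≤-C-suc {M} {s} 2s+1≤M) ⟩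
  ∣ M C suc s - C-below M s ∣                   ≡⟨ ∣m+n-m+o∣≡∣n-o∣ (M C s) (M C suc s) (C-below M s) ⟨
  ∣ M C s + M C suc s - M C s + C-below M s ∣   ≡⟨ cong₂ ∣_-_∣ next-row-middle (C-pascal-below M s) ⟨
  ∣ suc M C suc (suc s) - suc M C s ∣           ≡⟨ C-gap-suc (suc s) (suc M) ⟨
  C-gap (suc s) (suc (suc M))                   ∎
  where
  open ≤-Reasoning
  M = suc (suc s) + s
  2s+1≤M : suc (s + s) ≤ M
  2s+1≤M = n≤1+n _
  next-row-middle : suc M C suc (suc s) ≡ M C s + M C suc s
  next-row-middle = begin-equality
    suc M C suc (suc s)         ≡⟨ C-pascal M (suc s) ⟩
    M C suc s + M C suc (suc s) ≡⟨ cong (M C suc s +_) (C-+-sym (suc (suc s)) s) ⟩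
    M C suc s + M C s           ≡⟨ +-comm (M C suc s) (M C s) ⟩
    M C s + M C suc s           ∎

C-gap-mono : ∀ {t m n} → m ≤ n → n ≢ suc (t + t) → C-gap t m ≤ C-gap t n
C-gap-mono {t} {m} {n} m≤n n≢2t+1 with <-cmp n (suc (t + t))
... | tri< n<2t+1 _ _ = C-gap-mono-below (s≤s⁻¹ n<2t+1) m≤n
... | tri≈ _ n≡2t+1 _ = ⊥-elim (n≢2t+1 n≡2t+1)
... | tri> _ _ 2t+1<n with m ≤? t + t
...   | yes m≤2t = begin
  C-gap t m                      ≤⟨ C-gap-mono-below ≤-refl m≤2t ⟩
  C-gap t (t + t)                ≤⟨ C-gap-cross t ⟩
  C-gap t (suc (suc (t + t)))    ≤⟨ C-gap-mono-above (n≤1+n _) 2t+1<n ⟩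
  C-gap t n                      ∎
  where open ≤-Reasoning
...   | no m≰2t = C-gap-mono-above (≰⇒> m≰2t) m≤n

lemma2p2 : (j k n : ℕ) → 1 ≤ j → 1 ≤ k → 1 ≤ n → k ≤ n + 1 ∸ j → n ≢ 2 * k ∸ 1 →
    ∣ (n ∸ j) C k - (n ∸ j) C (k ∸ 1) ∣ ≤ ∣ n C k - n C (k ∸ 1) ∣
lemma2p2 j zero    n _ () _ _ _
lemma2p2 j (suc t) n _ _  _ _ n≢2k-1 = C-gap-mono (m∸n≤m n j) (λ n≡2t+1 → n≢2k-1 (trans n≡2t+1 2t+1≡2k-1))
  where
  2t+1≡2k-1 : suc (t + t) ≡ 2 * suc t ∸ 1
  2t+1≡2k-1 = trans (sym (+-suc t t)) (cong (λ z → t + suc z) (sym (+-identityʳ t)))
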